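{- Let $t,n$ be integers and let $P_L$ denote either the Alexander polynomial of $L$ (for every link $L$) or the Jones polynomial of $L$ (for every link $L$). Then the set $X'_{t,n}$ equals the set of isotopy classes of links $L$ of braid index three such that $e(L)=n$ and $P_L(-1)=i^n(t-2)$.
   Context: $B_3=\langle\sigma_1,\sigma_2:\sigma_1\sigma_2\sigma_1=\sigma_2\sigma_1\sigma_2\rangle$, $\phi:B_3\to\mathrm{SL}_2(\mathbb{Z})$ with $\phi(\sigma_1)=\begin{bmatrix}1&1\\0&1\end{bmatrix}$, $\phi(\sigma_2)=\begin{bmatrix}1&0\\-1&1\end{bmatrix}$, $\mathrm{tr}(g):=\mathrm{tr}(\phi(g))$, and $\epsilon$ the exponent sum ($\epsilon(\sigma_i)=1$). The braid index of a link is the least $m$ such that it is a closure of a braid in $B_m$; for $L$ of braid index $m\le 3$, $e(L)$ is the writhe of a diagram of $L$ obtained as the closure of a braid in $B_m$ (a link invariant). $X'_{t,n}$ is the set of isotopy classes of links $L$ of braid index three with $e(L)=n$ and $i^{\epsilon(g)}(\mathrm{tr}(g)-2)=i^n(t-2)$, where $L$ is the closure of $g\in B_3$ (this quantity is independent of $g$) and $i=\sqrt{ -1}$. The Alexander polynomial $\Delta_L$ and Jones polynomial $V_L$ in $\mathbb{Z}[\sqrt q,\sqrt q^{ -1}]$ are normalized as in Jones (1987): for $L$ the closure of $g\in B_3$ and $\beta_3$ the reduced Burau representation $\beta_3(\sigma_1)=\begin{bmatrix}1&-q\\0&-q\end{bmatrix}$, $\beta_3(\sigma_2)=\begin{bmatrix}-q&0\\-1&1\end{bmatrix}$,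 $\Delta_L(q)=\left(-\frac{1}{\sqrt q}\right)^{\epsilon(g)-2}\frac{1-\mathrm{tr}(\beta_3(g))+(-q)^{\epsilon(g)}}{1+q+q^2}$ and $V_L(q)=(\sqrt q)^{\epsilon(g)}(q+q^{ -1}+\mathrm{tr}(\beta_3(g)))$. Evaluation at $q=-1$ uses $\sqrt q\mapsto i$. -}

module Defs where

open import Data.Nat as ℕ using (ℕ; zero; suc)
open import Data.Integer as ℤ using (ℤ; +_; -[1+_]; 0ℤ; 1ℤ)
open import Data.Fin using (Fin; toℕ; inject₁; fromℕ)
open import Data.Bool using (Bool; true; false; not)
open import Data.List using (List; []; _∷_; _++_; map; foldr)
open import Data.Product using (Σ; ∃; ∃-syntax; _×_; _,_)
open import Data.Empty using (⊥)
open import Relation.Nullary using (¬_)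
open import Relation.Binary.PropositionalEquality using (_≡_)

-- Braid words.  A braid word on (suc k) strands is a list of generators
-- σ_{i+1}^{±1}, i : Fin k  (true = positive, false = inverse).
-- So B_{k+1} words = Word k;  B_3 words = Word 2.

Gen : ℕ → Set
Gen k = Fin k × Bool

Word : ℕ → Set
Word k = List (Gen k)

ε : ∀ {k} → Word k → ℤ
ε [] = 0ℤ
ε ((_ , true) ∷ w) = 1ℤ ℤ.+ ε w
ε ((_ , false) ∷ w) = ℤ.- 1ℤ ℤ.+ ε w

-- Links, as closures of braids, up to isotopy.  By Markov's theorem,
-- two closed braids are isotopic iff the braids are related by braid
-- group relations, conjugation and (de)stabilisation.  We take this as
-- the definition of link isotopy.  A link diagram = (k , w) meaning the
-- closure of w ∈ B_{k+1}.

Link : Set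
Link = Σ ℕ Word

data _~_ : Link → Link → Set where
  ~refl  : ∀ {L} → L ~ L
  ~sym   : ∀ {L M} → L ~ M → M ~ L
  ~trans : ∀ {L M N} → L ~ M → M ~ N → L ~ N
  cancel : ∀ {k} (u v : Word k) (i : Fin k) (s : Bool) →
           (k , u ++ ((i , s) ∷ (i , not s) ∷ v)) ~ (k , u ++ v)
  farComm : ∀ {k} (u v : Word k) (i j : Fin k) (a b : Bool) →
            suc (suc (toℕ i)) ℕ.≤ toℕ j →
            (k , u ++ ((i , a) ∷ (j , b) ∷ v)) ~ (k , u ++ ((j , b) ∷ (i , a) ∷ v))
  braidRel : ∀ {k} (u v : Word k) (i j : Fin k) → toℕ j ≡ suc (toℕ i) →
             (k , u ++ ((i , true) ∷ (j , true) ∷ (i , true) ∷ v))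
               ~ (k , u ++ ((j , true) ∷ (i , true) ∷ (j , true) ∷ v))
  conj : ∀ {k} (u v : Word k) → (k , u ++ v) ~ (k , v ++ u)
  stab : ∀ {k} (w : Word k) (s : Bool) →
         (k , w) ~ (suc k , map (λ { (i , b) → (inject₁ i , b) }) w ++ ((fromℕ k , s) ∷ []))

closureIn : ℕ → Link → Set
closureIn k L = ∃[ w ] (L ~ (k , w))

-- braid index of L is three: closure of a braid in B_3, but not of one in B_1 or B_2
BraidIndex3 : Link → Set
BraidIndex3 L = closureIn 2 L × ¬ closureIn 0 L × ¬ closureIn 1 L

infix 4 _+i_
record ℤi : Set where
  constructor _+i_
  field re im : ℤ

infixl 6 _⊕_
infixl 7 _⊗_
_⊕_ : ℤi → ℤi → ℤi
(a +i b) ⊕ (c +i d) = (a ℤ.+ c) +i (b ℤ.+ d)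

_⊗_ : ℤi → ℤi → ℤi
(a +i b) ⊗ (c +i d) = (a ℤ.* c ℤ.- b ℤ.* d) +i (a ℤ.* d ℤ.+ b ℤ.* c)

ineg : ℤi → ℤi
ineg (a +i b) = ℤ.- a +i ℤ.- b

fromℤ : ℤ → ℤi
fromℤ a = a +i 0ℤ

𝟘 𝟙 𝕚 : ℤi
𝟘 = fromℤ 0ℤ
𝟙 = fromℤ 1ℤ
𝕚 = 0ℤ +i 1ℤ

_^ₙ_ : ℤi → ℕ → ℤi
x ^ₙ zero = 𝟙
x ^ₙ suc n = x ⊗ (x ^ₙ n)

upow : ℤi → ℤi → ℤ → ℤi
upow x xinv (+ n) = x ^ₙ n
upow x xinv -[1+ n ] = xinv ^ₙ suc n

ipow : ℤ → ℤi
ipow = upow 𝕚 (ineg 𝕚)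

record M2 (A : Set) : Set where
  constructor mat
  field a b c d : A

mulℤ : M2 ℤ → M2 ℤ → M2 ℤ
mulℤ (mat a b c d) (mat a' b' c' d') =
  mat (a ℤ.* a' ℤ.+ b ℤ.* c') (a ℤ.* b' ℤ.+ b ℤ.* d')
      (c ℤ.* a' ℤ.+ d ℤ.* c') (c ℤ.* b' ℤ.+ d ℤ.* d')

idℤ : M2 ℤ
idℤ = mat 1ℤ 0ℤ 0ℤ 1ℤ

φgen : Gen 2 → M2 ℤ
φgen (Fin.zero , true)        = mat 1ℤ 1ℤ 0ℤ 1ℤ
φgen (Fin.zero , false)       = mat 1ℤ (ℤ.- 1ℤ) 0ℤ 1ℤ
φgen (Fin.suc Fin.zero , true)  = mat 1ℤ 0ℤ (ℤ.- 1ℤ) 1ℤ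
φgen (Fin.suc Fin.zero , false) = mat 1ℤ 0ℤ 1ℤ 1ℤ

φ : Word 2 → M2 ℤ
φ = foldr (λ g m → mulℤ (φgen g) m) idℤ

tr : Word 2 → ℤ
tr w = M2.a (φ w) ℤ.+ M2.d (φ w)

-- Evaluation of the Alexander and Jones polynomials at q = -1.
-- An evaluation point: values of q, q⁻¹, √q, √q⁻¹ and (1+q+q²)⁻¹ in ℤ[i].

record EvalPt : Set where
  field q qinv sq sqinv denInv : ℤi

-- q = -1, √q = i; then 1+q+q² = 1, whose inverse is 1.
atMinusOne : EvalPt
atMinusOne = record
  { q = ineg 𝟙 ; qinv = ineg 𝟙 ; sq = 𝕚 ; sqinv = ineg 𝕚 ; denInv = 𝟙 }

mulI : M2 ℤi → M2 ℤi → M2 ℤi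
mulI (mat a b c d) (mat a' b' c' d') =
  mat (a ⊗ a' ⊕ b ⊗ c') (a ⊗ b' ⊕ b ⊗ d')
      (c ⊗ a' ⊕ d ⊗ c') (c ⊗ b' ⊕ d ⊗ d')

idI : M2 ℤi
idI = mat 𝟙 𝟘 𝟘 𝟙

burauGen : EvalPt → Gen 2 → M2 ℤi
burauGen p (Data.Fin.zero , true)  = mat 𝟙 (ineg q) 𝟘 (ineg q)
  where open EvalPt p
burauGen p (Data.Fin.zero , false) = mat 𝟙 (ineg 𝟙) 𝟘 (ineg qinv)
  where open EvalPt p
burauGen p (Data.Fin.suc Data.Fin.zero , true)  = mat (ineg q) 𝟘 (ineg 𝟙) 𝟙
  where open EvalPt p
burauGen p (Data.Fin.suc Data.Fin.zero , false) = mat (ineg qinv) 𝟘 (ineg qinv) 𝟙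
  where open EvalPt p

burau : EvalPt → Word 2 → M2 ℤi
burau p = foldr (λ g m → mulI (burauGen p g) m) idI

trBurau : EvalPt → Word 2 → ℤi
trBurau p w = M2.a (burau p w) ⊕ M2.d (burau p w)

alexanderAt : EvalPt → Word 2 → ℤi
alexanderAt p w =
  upow (ineg sqinv) (ineg sq) (ε w ℤ.- + 2)
    ⊗ (𝟙 ⊕ ineg (trBurau p w) ⊕ upow (ineg q) (ineg qinv) (ε w))
    ⊗ denInv
  where open EvalPt p

jonesAt : EvalPt → Word 2 → ℤi
jonesAt p w = upow sq sqinv (ε w) ⊗ (q ⊕ qinv ⊕ trBurau p w)
  where open EvalPt p

data Poly : Set where
  Alexander Jones : Poly

P-at-1 : Poly → Word 2 → ℤi
P-at-1 Alexander = alexanderAt atMinusOne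
P-at-1 Jones     = jonesAt atMinusOne

X' : ℤ → ℤ → Link → Set
X' t n L = BraidIndex3 L ×
  ∃[ g ] ((L ~ (2 , g)) × ε g ≡ n ×
          ipow (ε g) ⊗ fromℤ (tr g ℤ.- + 2) ≡ ipow n ⊗ fromℤ (t ℤ.- + 2))

Y : Poly → ℤ → ℤ → Link → Set
Y P t n L = BraidIndex3 L ×
  ∃[ g ] ((L ~ (2 , g)) × ε g ≡ n ×
          P-at-1 P g ≡ ipow n ⊗ fromℤ (t ℤ.- + 2))

{-# OPTIONS --safe #-}
-- At q = -1, √q = i, the reduced Burau matrices of σ₁^{±1}, σ₂^{±1} are exactly
-- φ(σ₁)^{±1}, φ(σ₂)^{±1}, so tr β₃(g) evaluated at -1 is tr(g).  Since q + q⁻¹ = -2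
-- the Jones polynomial gives i^ε (tr g - 2) directly.  For the Alexander polynomial
-- 1 + q + q² = 1 and (-q)^ε = 1, leaving i^{ε-2} (2 - tr g), and i^{ε-2} = -i^ε.
module Submission where

open import Defs
open import Data.Integer using (ℤ)
open import Function.Bundles using (_⇔_; mk⇔)
open import Data.Nat using (zero; suc)
open import Data.Integer as ℤ using (+_; -[1+_]; 0ℤ; 1ℤ)
open import Data.Integer.Properties using (neg-involutive)
open import Data.Nat.Properties using (+-comm)
open import Data.Integer.Tactic.RingSolver using (solve-∀)
open import Data.Fin using (Fin)
open import Data.Bool using (true; false)
open import Data.List using ([]; _∷_)
open import Data.Product using (_,_)
open import Relation.Binary.PropositionalEquality
open ≡-Reasoning

mapM2 : {A B : Set} → (A → B) → M2 A → M2 B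
mapM2 f (mat a b c d) = mat (f a) (f b) (f c) (f d)

fromℤ-* : ∀ a b → fromℤ a ⊗ fromℤ b ≡ fromℤ (a ℤ.* b)
fromℤ-* a b = cong₂ _+i_ (re a b) (im a b)
  where
  re : ∀ a b → a ℤ.* b ℤ.- 0ℤ ℤ.* 0ℤ ≡ a ℤ.* b
  re = solve-∀
  im : ∀ a b → a ℤ.* 0ℤ ℤ.+ 0ℤ ℤ.* b ≡ 0ℤ
  im = solve-∀

fromℤ-dot : ∀ a b a' b' → fromℤ a ⊗ fromℤ a' ⊕ fromℤ b ⊗ fromℤ b' ≡ fromℤ (a ℤ.* a' ℤ.+ b ℤ.* b')
fromℤ-dot a b a' b' = cong₂ _⊕_ (fromℤ-* a a') (fromℤ-* b b')

mat-cong : {A : Set} {a b c d a' b' c' d' : A} →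
           a ≡ a' → b ≡ b' → c ≡ c' → d ≡ d' → mat a b c d ≡ mat a' b' c' d'
mat-cong refl refl refl refl = refl

mapM2-fromℤ-mul : ∀ A B → mulI (mapM2 fromℤ A) (mapM2 fromℤ B) ≡ mapM2 fromℤ (mulℤ A B)
mapM2-fromℤ-mul (mat a b c d) (mat a' b' c' d') =
  mat-cong (fromℤ-dot a b a' c') (fromℤ-dot a b b' d') (fromℤ-dot c d a' c') (fromℤ-dot c d b' d')

burauGen-atMinusOne : ∀ s → burauGen atMinusOne s ≡ mapM2 fromℤ (φgen s)
burauGen-atMinusOne (Fin.zero , true)  = refl
burauGen-atMinusOne (Fin.zero , false) = refl
burauGen-atMinusOne (Fin.suc Fin.zero , true)  = refl
burauGen-atMinusOne (Fin.suc Fin.zero , false) = refl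

burau-atMinusOne : ∀ w → burau atMinusOne w ≡ mapM2 fromℤ (φ w)
burau-atMinusOne []      = refl
burau-atMinusOne (s ∷ w) = begin
  mulI (burauGen atMinusOne s) (burau atMinusOne w)
    ≡⟨ cong₂ mulI (burauGen-atMinusOne s) (burau-atMinusOne w) ⟩
  mulI (mapM2 fromℤ (φgen s)) (mapM2 fromℤ (φ w))
    ≡⟨ mapM2-fromℤ-mul (φgen s) (φ w) ⟩
  mapM2 fromℤ (φ (s ∷ w)) ∎

trBurau-atMinusOne : ∀ w → trBurau atMinusOne w ≡ fromℤ (tr w)
trBurau-atMinusOne w = cong (λ M → M2.a M ⊕ M2.d M) (burau-atMinusOne w)

ineg-involutive : ∀ x → ineg (ineg x) ≡ x
ineg-involutive (a +i b) = cong₂ _+i_ (neg-involutive a) (neg-involutive b)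

j⊗j≡-1⇒j⊗[j⊗x]≡-x : ∀ j x → j ⊗ j ≡ ineg 𝟙 → j ⊗ (j ⊗ x) ≡ ineg x
j⊗j≡-1⇒j⊗[j⊗x]≡-x (p +i q) (a +i b) j² = cong₂ _+i_
  (trans (re p q a b) (trans (cong₂ (λ u v → u ℤ.* a ℤ.- v ℤ.* b) j²-re j²-im) (re-1 a b)))
  (trans (im p q a b) (trans (cong₂ (λ u v → u ℤ.* b ℤ.+ v ℤ.* a) j²-re j²-im) (im-1 a b)))
  where
  j²-re : p ℤ.* p ℤ.- q ℤ.* q ≡ ℤ.- 1ℤ
  j²-re = cong ℤi.re j²
  j²-im : p ℤ.* q ℤ.+ q ℤ.* p ≡ 0ℤ
  j²-im = cong ℤi.im j²
  re : ∀ p q a b → p ℤ.* (p ℤ.* a ℤ.- q ℤ.* b) ℤ.- q ℤ.* (p ℤ.* b ℤ.+ q ℤ.* a)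
                 ≡ (p ℤ.* p ℤ.- q ℤ.* q) ℤ.* a ℤ.- (p ℤ.* q ℤ.+ q ℤ.* p) ℤ.* b
  re = solve-∀
  im : ∀ p q a b → p ℤ.* (p ℤ.* b ℤ.+ q ℤ.* a) ℤ.+ q ℤ.* (p ℤ.* a ℤ.- q ℤ.* b)
                 ≡ (p ℤ.* p ℤ.- q ℤ.* q) ℤ.* b ℤ.+ (p ℤ.* q ℤ.+ q ℤ.* p) ℤ.* a
  im = solve-∀
  re-1 : ∀ a b → ℤ.- 1ℤ ℤ.* a ℤ.- 0ℤ ℤ.* b ≡ ℤ.- a
  re-1 = solve-∀
  im-1 : ∀ a b → ℤ.- 1ℤ ℤ.* b ℤ.+ 0ℤ ℤ.* a ≡ ℤ.- b
  im-1 = solve-∀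

ipow[k]≡-ipow[k-2] : ∀ k → ipow k ≡ ineg (ipow (k ℤ.- + 2))
ipow[k]≡-ipow[k-2] (+ 0) = refl
ipow[k]≡-ipow[k-2] (+ 1) = refl
ipow[k]≡-ipow[k-2] (+ suc (suc m)) = j⊗j≡-1⇒j⊗[j⊗x]≡-x 𝕚 (𝕚 ^ₙ m) refl
ipow[k]≡-ipow[k-2] -[1+ m ] rewrite +-comm m 1 = sym (begin
  ineg (ineg 𝕚 ⊗ (ineg 𝕚 ⊗ (ineg 𝕚 ^ₙ suc m)))
    ≡⟨ cong ineg (j⊗j≡-1⇒j⊗[j⊗x]≡-x (ineg 𝕚) _ refl) ⟩
  ineg (ineg (ineg 𝕚 ^ₙ suc m))
    ≡⟨ ineg-involutive _ ⟩
  ineg 𝕚 ^ₙ suc m ∎)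

𝟙^ₙ≡𝟙 : ∀ n → 𝟙 ^ₙ n ≡ 𝟙
𝟙^ₙ≡𝟙 zero    = refl
𝟙^ₙ≡𝟙 (suc n) = cong (𝟙 ⊗_) (𝟙^ₙ≡𝟙 n)

upow-𝟙 : ∀ k → upow 𝟙 𝟙 k ≡ 𝟙
upow-𝟙 (+ n)    = 𝟙^ₙ≡𝟙 n
upow-𝟙 -[1+ n ] = 𝟙^ₙ≡𝟙 (suc n)

x⊗[1-T+1]⊗1≡-x⊗[T-2] : ∀ x T → x ⊗ (𝟙 ⊕ ineg (fromℤ T) ⊕ 𝟙) ⊗ 𝟙 ≡ ineg x ⊗ fromℤ (T ℤ.- + 2)
x⊗[1-T+1]⊗1≡-x⊗[T-2] (a +i b) T = cong₂ _+i_ (re a b T) (im a b T)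
  where
  re : ∀ a b T → (a ℤ.* (1ℤ ℤ.+ ℤ.- T ℤ.+ 1ℤ) ℤ.- b ℤ.* (0ℤ ℤ.+ ℤ.- 0ℤ ℤ.+ 0ℤ)) ℤ.* 1ℤ
                   ℤ.- (a ℤ.* (0ℤ ℤ.+ ℤ.- 0ℤ ℤ.+ 0ℤ) ℤ.+ b ℤ.* (1ℤ ℤ.+ ℤ.- T ℤ.+ 1ℤ)) ℤ.* 0ℤ
               ≡ ℤ.- a ℤ.* (T ℤ.- + 2) ℤ.- ℤ.- b ℤ.* 0ℤ
  re = solve-∀
  im : ∀ a b T → (a ℤ.* (1ℤ ℤ.+ ℤ.- T ℤ.+ 1ℤ) ℤ.- b ℤ.* (0ℤ ℤ.+ ℤ.- 0ℤ ℤ.+ 0ℤ)) ℤ.* 0ℤ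
                   ℤ.+ (a ℤ.* (0ℤ ℤ.+ ℤ.- 0ℤ ℤ.+ 0ℤ) ℤ.+ b ℤ.* (1ℤ ℤ.+ ℤ.- T ℤ.+ 1ℤ)) ℤ.* 1ℤ
               ≡ ℤ.- a ℤ.* 0ℤ ℤ.+ ℤ.- b ℤ.* (T ℤ.- + 2)
  im = solve-∀

-1-1+T≡T-2 : ∀ T → ineg 𝟙 ⊕ ineg 𝟙 ⊕ fromℤ T ≡ fromℤ (T ℤ.- + 2)
-1-1+T≡T-2 T = cong (_+i 0ℤ) (re T)
  where
  re : ∀ T → ℤ.- 1ℤ ℤ.+ ℤ.- 1ℤ ℤ.+ T ≡ T ℤ.- + 2
  re = solve-∀

jonesAt-atMinusOne : ∀ g → jonesAt atMinusOne g ≡ ipow (ε g) ⊗ fromℤ (tr g ℤ.- + 2)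
jonesAt-atMinusOne g = cong (ipow (ε g) ⊗_) (begin
  ineg 𝟙 ⊕ ineg 𝟙 ⊕ trBurau atMinusOne g ≡⟨ cong (ineg 𝟙 ⊕ ineg 𝟙 ⊕_) (trBurau-atMinusOne g) ⟩
  ineg 𝟙 ⊕ ineg 𝟙 ⊕ fromℤ (tr g)         ≡⟨ -1-1+T≡T-2 (tr g) ⟩
  fromℤ (tr g ℤ.- + 2)                    ∎)

alexanderAt-atMinusOne : ∀ g → alexanderAt atMinusOne g ≡ ipow (ε g) ⊗ fromℤ (tr g ℤ.- + 2)
alexanderAt-atMinusOne g = begin
  ipow (ε g ℤ.- + 2) ⊗ (𝟙 ⊕ ineg (trBurau atMinusOne g) ⊕ upow 𝟙 𝟙 (ε g)) ⊗ 𝟙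
    ≡⟨ cong₂ (λ T u → ipow (ε g ℤ.- + 2) ⊗ (𝟙 ⊕ ineg T ⊕ u) ⊗ 𝟙)
             (trBurau-atMinusOne g) (upow-𝟙 (ε g)) ⟩
  ipow (ε g ℤ.- + 2) ⊗ (𝟙 ⊕ ineg (fromℤ (tr g)) ⊕ 𝟙) ⊗ 𝟙
    ≡⟨ x⊗[1-T+1]⊗1≡-x⊗[T-2] (ipow (ε g ℤ.- + 2)) (tr g) ⟩
  ineg (ipow (ε g ℤ.- + 2)) ⊗ fromℤ (tr g ℤ.- + 2)
    ≡⟨ cong (_⊗ fromℤ (tr g ℤ.- + 2)) (sym (ipow[k]≡-ipow[k-2] (ε g))) ⟩
  ipow (ε g) ⊗ fromℤ (tr g ℤ.- + 2) ∎

P-at-1≡ipow⊗[tr-2] : ∀ P g → P-at-1 P g ≡ ipow (ε g) ⊗ fromℤ (tr g ℤ.- + 2)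
P-at-1≡ipow⊗[tr-2] Alexander = alexanderAt-atMinusOne
P-at-1≡ipow⊗[tr-2] Jones     = jonesAt-atMinusOne

lemma5p1 : (P : Poly) (t n : ℤ) (L : Link) → X' t n L ⇔ Y P t n L
lemma5p1 P t n L = mk⇔
  (λ { (bi , g , L~g , εg≡n , e) → bi , g , L~g , εg≡n , trans (P-at-1≡ipow⊗[tr-2] P g) e })
  (λ { (bi , g , L~g , εg≡n , e) → bi , g , L~g , εg≡n , trans (sym (P-at-1≡ipow⊗[tr-2] P g)) e })
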